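{- A configuration is a triangle basis if and only if it is either a single point or a shifted sum (vertical, horizontal or diagonal, with some shift $h$) of two triangle bases.
   Context: Work in a TEP subshift with window $S=\{(0,0),(1,0),(0,1)\}$ on $\mathbb{Z}^2$: for each pattern on $S$ with one cell left empty there is a unique symbol completing it into an allowed pattern. For $P\subset\mathbb{Z}^2$, a filling step consists in choosing a position $(x,y)$ with $|P\cap\{(x,y),(x+1,y),(x,y+1)\}|=2$ and adding the missing cell to $P$; this process is confluent and its limit is the filling $\varphi(P)$. Let $T_n=\{(x,y)\mid x,y\in\mathbb{N},\ x+y<n\}$ be the triangle of size $n$. A configuration of size $n$ is a set of $n$ points $C\subset T_n$. A set $P$ is a triangle basis of $T_n$ if for any coloring of $P$ by symbols, iteratively deducing values by the TEP rules always yields a valid coloring of all of $T_n$ (everything determined, no conflict); equivalently (known result), a configuration of size $n$ is a triangle basis iff its filling is $T_n$. Two sets $A,B$ touch if some $a\in A$, $b\in B$ satisfy $a=b$ or differ by $(0,1)$, $(1,0)$ or $(1,-1)$. Shifted sums: let $C_1,C_2$ be configurations and $h\in\{0,\dots,|C_1|\}$. The $h$-vertically shifted sum is $((|C_2|,0)+C_1)\cup((0,h)+C_2)$; the $h$-horizontally shifted sum is $((0,|C_2|)+C_1)\cup((h,0)+C_2)$; the $h$-diagonally shifted sum is $C_1\cup((|C_1|-h,h)+C_2)$. Each is a configuration of size $|C_1|+|C_2|$. -}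

module Defs where

open import Data.Nat using (ℕ; zero; suc; _+_; _∸_; _<_; _≤_)
open import Data.Product using (_×_; _,_; ∃-syntax)
open import Data.Sum using (_⊎_)
open import Data.List using (List; []; _∷_; map; length; _++_)
open import Data.List.Relation.Unary.All using (All)
open import Data.List.Relation.Unary.Unique.Propositional using (Unique)
open import Data.List.Membership.Propositional using (_∈_)
open import Function.Bundles using (_⇔_)
open import Relation.Binary.PropositionalEquality using (_≡_)

Pt : Set
Pt = ℕ × ℕ

_⊕_ : Pt → Pt → Pt
(a , b) ⊕ (x , y) = (a + x , b + y)

InT : ℕ → Pt → Set
InT n (x , y) = x + y < n

-- a configuration of size n: a set of n points contained in T_n
-- (represented by a duplicate-free list of length n)
IsConfig : ℕ → List Pt → Set
IsConfig n C = Unique C × length C ≡ n × All (InT n) C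

-- The filling φ(P): the limit of the (confluent) filling process, i.e. the
-- least set containing P and closed under completing a window
-- {(x,y),(x+1,y),(x,y+1)} whenever two of its cells are present.
data Fill (P : List Pt) : Pt → Set where
  base : ∀ {p} → p ∈ P → Fill P p
  fill-up    : ∀ {x y} → Fill P (x , y) → Fill P (suc x , y) → Fill P (x , suc y)
  fill-right : ∀ {x y} → Fill P (x , y) → Fill P (x , suc y) → Fill P (suc x , y)
  fill-corner : ∀ {x y} → Fill P (suc x , y) → Fill P (x , suc y) → Fill P (x , y)

-- triangle basis of T_n (via the known characterisation: a configuration of
-- size n whose filling is exactly T_n)
TriangleBasis : ℕ → List Pt → Set
TriangleBasis n C = IsConfig n C × (∀ p → Fill C p ⇔ InT n p)

_≋_ : List Pt → List Pt → Set
A ≋ B = ∀ p → (p ∈ A) ⇔ (p ∈ B)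

vSum : List Pt → List Pt → ℕ → List Pt
vSum C₁ C₂ h = map ((length C₂ , 0) ⊕_) C₁ ++ map ((0 , h) ⊕_) C₂

hSum : List Pt → List Pt → ℕ → List Pt
hSum C₁ C₂ h = map ((0 , length C₂) ⊕_) C₁ ++ map ((h , 0) ⊕_) C₂

dSum : List Pt → List Pt → ℕ → List Pt
dSum C₁ C₂ h = C₁ ++ map ((length C₁ ∸ h , h) ⊕_) C₂

{-# OPTIONS --safe #-}
module Submission where

-- Shifted sums are bases: the two translated triangles T_{n₁} and T_{n₂} lie in the filling and touch, a
-- set closed under the filling rules that contains two touching triangles contains their hull, here
-- T_{n₁+n₂}, and counting points shows that the filling is exactly T_n.
--
-- Bases are shifted sums: start from the n one-point blocks and repeatedly merge two blocks whose triangles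
-- touch.  The hull of the two triangles is filled by the merged points and its side is at most the sum of
-- the two sides, hence at most the number of points.  Once no two blocks touch, the union of their
-- triangles is closed under filling, so it covers T_n; the block at the origin is then T_n itself and holds
-- all n points.  In its last merge both halves have side equal to their number of points, so they are
-- translated triangle bases, and as their hull is T_n they sit in one of the three shifted-sum positions.

open import Defs
open import Data.Nat using (ℕ; zero; suc; _+_; _∸_; _⊓_; _⊔_; _≤_; _<_; _≤′_; ≤′-refl; ≤′-step; z≤n; s≤s; z<s)
open import Data.Nat.Properties
open import Data.Product using (_×_; _,_; proj₁; proj₂; ∃; ∃-syntax)
open import Data.Sum using (_⊎_; inj₁; inj₂) renaming (swap to ⊎-swap)
open import Data.Empty using (⊥-elim)
open import Data.List using (List; []; _∷_; [_]; map; length; _++_)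
open import Data.List.Relation.Unary.All as All using (All; []; _∷_)
open import Data.List.Relation.Unary.All.Properties using (++⁺; ++⁻ˡ; map⁺)
open import Data.List.Membership.Propositional using (_∈_; find; lose)
open import Data.List.Membership.Propositional.Properties using (∈-map⁺; ∈-map⁻; ∈-++⁺ˡ; ∈-++⁺ʳ; ∈-++⁻; ∈-∃++)
open import Data.List.Properties using (length-++; length-map; map-id; ++-assoc; ++-identityʳ)
open import Data.List.Relation.Unary.Any as Any using (Any; here; there)
open import Data.List.Relation.Unary.AllPairs using ([]; _∷_)
open import Data.List.Relation.Unary.Unique.Propositional using (Unique)
open import Data.List.Relation.Unary.Unique.Propositional.Properties using (map⁻)
open import Data.List.Relation.Binary.Permutation.Propositional as ↭
  using (_↭_; ↭-refl; ↭-reflexive; ↭-sym; ↭-trans; prep; swap; ↭⇒↭ₛ)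
import Data.List.Relation.Binary.Permutation.Setoid.Properties as Setoid↭
open import Data.List.Relation.Binary.Permutation.Propositional.Properties
  using (shift; shifts; ++⁺ˡ; ++-comm; ∈-resp-↭; ↭-length)
open import Algebra.Properties.CommutativeSemigroup +-commutativeSemigroup using (interchange)
open import Function.Base using (_∘_; id)
open import Function.Bundles using (_⇔_; mk⇔; Equivalence)
open import Relation.Nullary using (¬_; Dec; yes; no)
open import Relation.Nullary.Decidable using (_×-dec_)
open import Relation.Unary using (_⊆_; _∩_; ∁; Decidable)
open import Relation.Binary.PropositionalEquality using (_≡_; refl; sym; trans; cong; cong₂; subst; subst₂; setoid)

spread : ∀ {P : ℕ → Set} {lo v} → P v →
         (∀ {q} → v ≤ q → P q → P (suc q)) →
         (∀ {q} → lo ≤ q → q < v → P (suc q) → P q) →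
         ∀ {q} → lo ≤ q → P q
spread {P} {lo} {v} Pv up down {q} lo≤q with v ≤? q
... | yes v≤q = upward (≤⇒≤′ v≤q)
  where
  upward : ∀ {q} → v ≤′ q → P q
  upward ≤′-refl        = Pv
  upward (≤′-step v≤′q) = up (≤′⇒≤ v≤′q) (upward v≤′q)
... | no v≰q = downward (v ∸ q) lo≤q (m+[n∸m]≡n (<⇒≤ (≰⇒> v≰q)))
  where
  downward : ∀ d {q} → lo ≤ q → q + d ≡ v → P q
  downward zero    {q} _    q+0≡v = subst P (trans (sym q+0≡v) (+-identityʳ q)) Pv
  downward (suc d) {q} lo≤q q+d≡v =
    down lo≤q (subst (q <_) q+d≡v (m<m+n q z<s)) (downward d (m≤n⇒m≤1+n lo≤q) (trans (sym (+-suc q d)) q+d≡v))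

suc-∸-≤ : ∀ m n → suc m ∸ n ≤ suc (m ∸ n)
suc-∸-≤ m n = m≤n+o⇒m∸n≤o (suc m) n (≤-trans (s≤s (m≤n+m∸n m n)) (≤-reflexive (sym (+-suc n (m ∸ n)))))

tight-+ : ∀ {a b c d} → a ≤ c → b ≤ d → c + d ≤ a + b → a ≡ c × b ≡ d
tight-+ {a} {b} {c} {d} a≤c b≤d c+d≤a+b =
  ≤-antisym a≤c (+-cancelʳ-≤ d c a (≤-trans c+d≤a+b (+-monoʳ-≤ a b≤d))) ,
  ≤-antisym b≤d (+-cancelˡ-≤ c d b (≤-trans c+d≤a+b (+-monoˡ-≤ b a≤c)))

⊓≡0 : ∀ m n → m ⊓ n ≡ 0 → m ≡ 0 ⊎ n ≡ 0
⊓≡0 m n m⊓n≡0 with ⊓-sel m n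
... | inj₁ m⊓n≡m = inj₁ (trans (sym m⊓n≡m) m⊓n≡0)
... | inj₂ m⊓n≡n = inj₂ (trans (sym m⊓n≡n) m⊓n≡0)

∈-↭ : ∀ {A : Set} {x : A} {xs} → x ∈ xs → ∃ λ ys → xs ↭ x ∷ ys
∈-↭ x∈xs with ys , zs , refl ← ∈-∃++ x∈xs = ys ++ zs , shift _ ys zs

prefix-↭ : ∀ {A : Set} {xs ys zs : List A} → xs ++ ys ↭ zs → length zs ≤ length xs → xs ↭ zs
prefix-↭ {xs = xs} {[]} xs↭zs _ = subst (_↭ _) (++-identityʳ xs) xs↭zs
prefix-↭ {xs = xs} {y ∷ ys} xs++ys↭zs |zs|≤|xs| =
  ⊥-elim (<-irrefl refl (≤-trans (≤-trans longer (≤-reflexive (↭-length xs++ys↭zs))) |zs|≤|xs|))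
  where
  longer : suc (length xs) ≤ length (xs ++ y ∷ ys)
  longer = subst (suc (length xs) ≤_) (sym (trans (length-++ xs) (+-suc (length xs) (length ys))))
                 (s≤s (m≤m+n _ _))

Unique-⊆⇒length≤ : ∀ {A : Set} {xs ys : List A} → Unique xs → (_∈ xs) ⊆ (_∈ ys) → length xs ≤ length ys
Unique-⊆⇒length≤ {xs = []} _ _ = z≤n
Unique-⊆⇒length≤ {xs = x ∷ xs} (x∉xs ∷ uniq) xs⊆ys with ys′ , ys↭ ← ∈-↭ (xs⊆ys (here refl)) =
  subst (suc (length xs) ≤_) (sym (↭-length ys↭)) (s≤s (Unique-⊆⇒length≤ uniq xs⊆ys′))
  where
  xs⊆ys′ : (_∈ xs) ⊆ (_∈ ys′)
  xs⊆ys′ z∈xs with ∈-resp-↭ ys↭ (xs⊆ys (there z∈xs))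
  ... | here refl   = ⊥-elim (All.lookup x∉xs z∈xs refl)
  ... | there z∈ys′ = z∈ys′

Unique-++⁻ : ∀ {A : Set} (xs : List A) {ys} → Unique (xs ++ ys) → Unique xs × Unique ys
Unique-++⁻ []       uniq        = [] , uniq
Unique-++⁻ (x ∷ xs) (x∉ ∷ uniq) = (++⁻ˡ xs x∉ ∷ proj₁ (Unique-++⁻ xs uniq)) , proj₂ (Unique-++⁻ xs uniq)

Unique-resp-↭ : ∀ {A : Set} {xs ys : List A} → xs ↭ ys → Unique xs → Unique ys
Unique-resp-↭ {A} xs↭ys = Setoid↭.Unique-resp-↭ (setoid A) (↭⇒↭ₛ xs↭ys)

↭⇒≋ : ∀ {xs ys} → xs ↭ ys → ys ≋ xs
↭⇒≋ xs↭ys p = mk⇔ (∈-resp-↭ (↭-sym xs↭ys)) (∈-resp-↭ xs↭ys)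

≋-swap : ∀ {C} A B → C ≋ (A ++ B) → C ≋ (B ++ A)
≋-swap A B C≋ p =
  mk⇔ (∈-resp-↭ (++-comm A B) ∘ Equivalence.to (C≋ p)) (Equivalence.from (C≋ p) ∘ ∈-resp-↭ (++-comm B A))

data Any₂ {A : Set} (P Q : A → Set) : List A → Set where
  here-P : ∀ {x xs} → P x → Any Q xs → Any₂ P Q (x ∷ xs)
  here-Q : ∀ {x xs} → Q x → Any P xs → Any₂ P Q (x ∷ xs)
  there₂ : ∀ {x xs} → Any₂ P Q xs → Any₂ P Q (x ∷ xs)

module _ {A : Set} {P Q : A → Set} where

  any₂? : Decidable P → Decidable Q → Decidable (Any₂ P Q)
  any₂? P? Q? [] = no λ ()
  any₂? P? Q? (x ∷ xs) with any₂? P? Q? xs | P? x ×-dec Any.any? Q? xs | Q? x ×-dec Any.any? P? xs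
  ... | yes two    | _               | _               = yes (there₂ two)
  ... | no _       | yes (px , qxs)  | _               = yes (here-P px qxs)
  ... | no _       | no _            | yes (qx , pxs)  = yes (here-Q qx pxs)
  ... | no ¬two    | no ¬here-P      | no ¬here-Q      = no λ
    { (here-P px qxs) → ¬here-P (px , qxs)
    ; (here-Q qx pxs) → ¬here-Q (qx , pxs)
    ; (there₂ two)    → ¬two two
    }

  Any₂-or-Any∩ : ∀ {xs} → Any P xs → Any Q xs → Any₂ P Q xs ⊎ Any (P ∩ Q) xs
  Any₂-or-Any∩ (here px)  (here qx)  = inj₂ (here (px , qx))
  Any₂-or-Any∩ (here px)  (there qs) = inj₁ (here-P px qs)
  Any₂-or-Any∩ (there ps) (here qx)  = inj₁ (here-Q qx ps)
  Any₂-or-Any∩ (there ps) (there qs) with Any₂-or-Any∩ ps qs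
  ... | inj₁ two  = inj₁ (there₂ two)
  ... | inj₂ both = inj₂ (there both)

  Any₂-separate : ∀ {xs} → Any (P ∩ ∁ Q) xs → Any Q xs → Any₂ P Q xs
  Any₂-separate (here (_ , ¬qx)) (here qx) = ⊥-elim (¬qx qx)
  Any₂-separate (here (px , _))  (there qs) = here-P px qs
  Any₂-separate (there ps)       (here qx)  = here-Q qx (Any.map proj₁ ps)
  Any₂-separate (there ps)       (there qs) = there₂ (Any₂-separate ps qs)

  Any₂-↭ : ∀ {xs} → Any₂ P Q xs → ∃[ x ] ∃[ y ] ∃[ zs ] (P x × Q y × xs ↭ x ∷ y ∷ zs)
  Any₂-↭ (here-P {x} px qs)
    with y , y∈xs , qy ← find qs
    with zs , xs↭ ← ∈-↭ y∈xs
    = x , y , zs , px , qy , prep x xs↭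
  Any₂-↭ (here-Q {x} qx ps)
    with y , y∈xs , py ← find ps
    with zs , xs↭ ← ∈-↭ y∈xs
    = y , x , zs , py , qx , ↭-trans (prep x xs↭) (swap x y ↭-refl)
  Any₂-↭ (there₂ {x} two) with x′ , y′ , zs , px′ , qy′ , xs↭ ← Any₂-↭ two =
    x′ , y′ , x ∷ zs , px′ , qy′ , ↭-trans (prep x xs↭) (shifts [ x ] (x′ ∷ [ y′ ]))

-- Closure under filling

record FillClosed (F : Pt → Set) : Set where
  field
    close-up     : ∀ {x y} → F (x , y) → F (suc x , y) → F (x , suc y)
    close-right  : ∀ {x y} → F (x , y) → F (x , suc y) → F (suc x , y)
    close-corner : ∀ {x y} → F (suc x , y) → F (x , suc y) → F (x , y)
open FillClosed public

Fill-closed : ∀ P → FillClosed (Fill P)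
Fill-closed P = record { close-up = fill-up ; close-right = fill-right ; close-corner = fill-corner }

Fill-least : ∀ {F P} → FillClosed F → (_∈ P) ⊆ F → Fill P ⊆ F
Fill-least cl P⊆F (base p∈P)        = P⊆F p∈P
Fill-least cl P⊆F (fill-up p q)     = close-up cl (Fill-least cl P⊆F p) (Fill-least cl P⊆F q)
Fill-least cl P⊆F (fill-right p q)  = close-right cl (Fill-least cl P⊆F p) (Fill-least cl P⊆F q)
Fill-least cl P⊆F (fill-corner p q) = close-corner cl (Fill-least cl P⊆F p) (Fill-least cl P⊆F q)

Fill-mono : ∀ {P Q} → (_∈ P) ⊆ (_∈ Q) → Fill P ⊆ Fill Q
Fill-mono P⊆Q = Fill-least (Fill-closed _) (λ p∈P → base (P⊆Q p∈P))

FillClosed-translate : ∀ {F} v → FillClosed F → FillClosed (λ p → F (v ⊕ p))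
FillClosed-translate {F} (a , b) cl = record
  { close-up     = λ {x} {y} p q →
      subst (λ z → F (a + x , z)) (sym (+-suc b y)) (close-up cl p (subst (λ z → F (z , b + y)) (+-suc a x) q))
  ; close-right  = λ {x} {y} p q →
      subst (λ z → F (z , b + y)) (sym (+-suc a x)) (close-right cl p (subst (λ z → F (a + x , z)) (+-suc b y) q))
  ; close-corner = λ {x} {y} p q →
      close-corner cl (subst (λ z → F (z , b + y)) (+-suc a x) p) (subst (λ z → F (a + x , z)) (+-suc b y) q)
  }

-- The translate (a , b) + F, with the truncated subtractions guarded by a ≤ u and b ≤ w.
FillClosed-untranslate : ∀ {F} a b → FillClosed F →
                         FillClosed (λ { (u , w) → a ≤ u × b ≤ w × F (u ∸ a , w ∸ b) })
FillClosed-untranslate {F} a b cl = record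
  { close-up     = λ { {u} {w} (a≤u , b≤w , p) (_ , _ , q) → a≤u , m≤n⇒m≤1+n b≤w ,
      subst (λ z → F (u ∸ a , z)) (sym (+-∸-assoc 1 b≤w)) (close-up cl p (shift₁ a≤u q)) }
  ; close-right  = λ { {u} {w} (a≤u , b≤w , p) (_ , _ , q) → m≤n⇒m≤1+n a≤u , b≤w ,
      subst (λ z → F (z , w ∸ b)) (sym (+-∸-assoc 1 a≤u)) (close-right cl p (shift₂ b≤w q)) }
  ; close-corner = λ { (_ , b≤w , p) (a≤u , _ , q) → a≤u , b≤w , close-corner cl (shift₁ a≤u p) (shift₂ b≤w q) }
  }
  where
  shift₁ : ∀ {u v} → a ≤ u → F (suc u ∸ a , v) → F (suc (u ∸ a) , v)
  shift₁ {v = v} a≤u = subst (λ z → F (z , v)) (+-∸-assoc 1 a≤u)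
  shift₂ : ∀ {u v} → b ≤ v → F (u , suc v ∸ b) → F (u , suc (v ∸ b))
  shift₂ {u} b≤v = subst (λ z → F (u , z)) (+-∸-assoc 1 b≤v)

Fill-translate : ∀ v P {p} → Fill P p → Fill (map (v ⊕_) P) (v ⊕ p)
Fill-translate v P = Fill-least (FillClosed-translate v (Fill-closed _)) (λ p∈P → base (∈-map⁺ (v ⊕_) p∈P))

Fill-untranslate : ∀ a b P {u w} → Fill (map ((a , b) ⊕_) P) (a + u , b + w) → Fill P (u , w)
Fill-untranslate a b P {u} {w} p =
  subst (Fill P) (cong₂ _,_ (m+n∸m≡n a u) (m+n∸m≡n b w))
    (proj₂ (proj₂ (Fill-least (FillClosed-untranslate a b (Fill-closed P)) shifted p)))
  where
  shifted : (_∈ map ((a , b) ⊕_) P) ⊆ _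
  shifted q∈ with (x , y) , x,y∈P , refl ← ∈-map⁻ ((a , b) ⊕_) q∈ =
    m≤m+n a x , m≤m+n b y , subst (Fill P) (sym (cong₂ _,_ (m+n∸m≡n a x) (m+n∸m≡n b y))) (base x,y∈P)

InT-closed : ∀ n → FillClosed (InT n)
InT-closed n = record
  { close-up     = λ { {x} {y} _ q → subst (_< n) (sym (+-suc x y)) q }
  ; close-right  = λ { {x} {y} _ q → subst (_< n) (+-suc x y) q }
  ; close-corner = λ { {x} {y} p _ → <-trans (n<1+n (x + y)) p }
  }

Fill⊆InT : ∀ {n C} → All (InT n) C → Fill C ⊆ InT n
Fill⊆InT C⊆T = Fill-least (InT-closed _) (All.lookup C⊆T)

-- Triangles

record Triangle : Set where
  constructor tri
  field
    left bottom bound : ℕ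
open Triangle public

InTri : Triangle → Pt → Set
InTri (tri x y s) (u , v) = x ≤ u × y ≤ v × u + v < s

InTri? : ∀ t p → Dec (InTri t p)
InTri? (tri x y s) (u , v) = x ≤? u ×-dec y ≤? v ×-dec u + v <? s

level : Triangle → ℕ
level t = left t + bottom t

side : Triangle → ℕ
side t = bound t ∸ level t

NonEmpty : Triangle → Set
NonEmpty t = level t < bound t

-- Corner (x , y) and side m; the bound is written m + (x + y) so that bound (pt (u , v)) is suc (u + v).
triangle : ℕ → ℕ → ℕ → Triangle
triangle x y m = tri x y (m + (x + y))

pt : Pt → Triangle
pt (u , v) = triangle u v 1

hull : Triangle → Triangle → Triangle
hull (tri x y s) (tri x′ y′ s′) = tri (x ⊓ x′) (y ⊓ y′) (s ⊔ s′)

side-triangle : ∀ x y m → side (triangle x y m) ≡ m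
side-triangle x y m = m+n∸n≡m m (x + y)

NonEmpty⇒triangle : ∀ t → NonEmpty t → t ≡ triangle (left t) (bottom t) (side t)
NonEmpty⇒triangle (tri x y s) x+y<s = cong (tri x y) (sym (m∸n+n≡m (<⇒≤ x+y<s)))

NonEmpty⇒sized : ∀ {x y s} → x + y < s → ∃ λ k → s ≡ suc k + (x + y)
NonEmpty⇒sized {x} {y} {s} x+y<s = k , sym (trans (sym (+-suc k (x + y))) (m∸n+n≡m x+y<s))
  where k = s ∸ suc (x + y)

InTri-closed : ∀ t → FillClosed (InTri t)
InTri-closed (tri x y s) = record
  { close-up     = λ { {u} {v} (x≤u , y≤v , _) (_ , _ , lt) →
                       x≤u , m≤n⇒m≤1+n y≤v , subst (_< s) (sym (+-suc u v)) lt }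
  ; close-right  = λ { {u} {v} (x≤u , y≤v , _) (_ , _ , lt) →
                       m≤n⇒m≤1+n x≤u , y≤v , subst (_< s) (+-suc u v) lt }
  ; close-corner = λ { {u} {v} (_ , y≤v , lt) (x≤u , _ , _) → x≤u , y≤v , <-trans (n<1+n (u + v)) lt }
  }

Fill⊆InTri : ∀ {t P} → All (InTri t) P → Fill P ⊆ InTri t
Fill⊆InTri P⊆t = Fill-least (InTri-closed _) (All.lookup P⊆t)

InTri-mono : ∀ {x y s x′ y′ s′} → x′ ≤ x → y′ ≤ y → s ≤ s′ → InTri (tri x y s) ⊆ InTri (tri x′ y′ s′)
InTri-mono x′≤x y′≤y s≤s′ (x≤u , y≤v , u+v<s) =
  ≤-trans x′≤x x≤u , ≤-trans y′≤y y≤v , <-≤-trans u+v<s s≤s′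

InTri-hullˡ : ∀ A B → InTri A ⊆ InTri (hull A B)
InTri-hullˡ (tri x y s) (tri x′ y′ s′) = InTri-mono (m⊓n≤m x x′) (m⊓n≤m y y′) (m≤m⊔n s s′)

InTri-hullʳ : ∀ A B → InTri B ⊆ InTri (hull A B)
InTri-hullʳ (tri x y s) (tri x′ y′ s′) = InTri-mono (m⊓n≤n x x′) (m⊓n≤n y y′) (m≤n⊔m s s′)

hull-nonempty : ∀ A B → NonEmpty A → NonEmpty (hull A B)
hull-nonempty (tri x y s) (tri x′ y′ s′) x+y<s =
  <-≤-trans (≤-<-trans (+-mono-≤ (m⊓n≤m x x′) (m⊓n≤m y y′)) x+y<s) (m≤m⊔n s s′)

hull-assoc : ∀ A B C → hull (hull A B) C ≡ hull A (hull B C)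
hull-assoc (tri x y s) (tri x′ y′ s′) (tri x″ y″ s″)
  rewrite ⊓-assoc x x′ x″ | ⊓-assoc y y′ y″ | ⊔-assoc s s′ s″ = refl

InTri-pt : ∀ p → InTri (pt p) p
InTri-pt (u , v) = ≤-refl , ≤-refl , n<1+n (u + v)

InTri-pt⁻ : ∀ {p q} → InTri (pt p) q → q ≡ p
InTri-pt⁻ {x , y} {u , v} (x≤u , y≤v , s≤s u+v≤x+y) = cong₂ _,_
  (≤-antisym (+-cancelʳ-≤ v u x (≤-trans u+v≤x+y (+-monoʳ-≤ x y≤v))) x≤u)
  (≤-antisym (+-cancelˡ-≤ u v y (≤-trans u+v≤x+y (+-monoˡ-≤ y x≤u))) y≤v)

InTri-origin : ∀ t → InTri t (0 , 0) → t ≡ tri 0 0 (bound t)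
InTri-origin (tri .0 .0 s) (z≤n , z≤n , _) = refl

InTri-triangle⇒InT : ∀ {a b m u v} → InTri (triangle a b m) (a + u , b + v) → InT m (u , v)
InTri-triangle⇒InT {a} {b} {m} {u} {v} (_ , _ , lt) =
  +-cancelʳ-< (a + b) (u + v) m (subst (_< m + (a + b)) (trans (interchange a u b v) (+-comm (a + b) (u + v))) lt)

InT⇒InTri-triangle : ∀ {a b m u v} → InT m (u , v) → InTri (triangle a b m) (a + u , b + v)
InT⇒InTri-triangle {a} {b} {m} {u} {v} lt =
  m≤m+n a u , m≤m+n b v ,
  subst (_< m + (a + b)) (sym (trans (interchange a u b v) (+-comm (a + b) (u + v)))) (+-monoˡ-< (a + b) lt)

InT⊆InTri : ∀ {N} t → left t ≤ 0 → bottom t ≤ 0 → N ≤ bound t → InT N ⊆ InTri t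
InT⊆InTri (tri x y s) x≤0 y≤0 N≤s {u , v} u+v<N = ≤-trans x≤0 z≤n , ≤-trans y≤0 z≤n , <-≤-trans u+v<N N≤s

unshift : Pt → Pt → Pt
unshift (a , b) (u , v) = (u ∸ a , v ∸ b)

⊕-unshift : ∀ {a b u v} → a ≤ u → b ≤ v → (a , b) ⊕ unshift (a , b) (u , v) ≡ (u , v)
⊕-unshift a≤u b≤v = cong₂ _,_ (m+[n∸m]≡n a≤u) (m+[n∸m]≡n b≤v)

shift-unshift : ∀ {x y s} {g : List Pt} → All (InTri (tri x y s)) g → map ((x , y) ⊕_) (map (unshift (x , y)) g) ≡ g
shift-unshift []                        = refl
shift-unshift ((x≤u , y≤v , _) ∷ g⊆T) = cong₂ _∷_ (⊕-unshift x≤u y≤v) (shift-unshift g⊆T)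

data Adjacent : Pt → Pt → Set where
  east      : ∀ {x y} → Adjacent (x , y) (suc x , y)
  west      : ∀ {x y} → Adjacent (suc x , y) (x , y)
  north     : ∀ {x y} → Adjacent (x , y) (x , suc y)
  south     : ∀ {x y} → Adjacent (x , suc y) (x , y)
  northwest : ∀ {x y} → Adjacent (suc x , y) (x , suc y)
  southeast : ∀ {x y} → Adjacent (x , suc y) (suc x , y)

Adjacent-sum : ∀ {u v a b} → Adjacent (u , v) (a , b) → u + v ≤ suc (a + b)
Adjacent-sum {x} {y} east          = m≤n⇒m≤1+n (n≤1+n (x + y))
Adjacent-sum west                  = ≤-refl
Adjacent-sum {x} {y} north         = m≤n⇒m≤1+n (≤-trans (n≤1+n (x + y)) (≤-reflexive (sym (+-suc x y))))
Adjacent-sum {x} {suc y} south     = ≤-reflexive (+-suc x y)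
Adjacent-sum {suc x} {y} northwest = s≤s (≤-trans (n≤1+n (x + y)) (≤-reflexive (sym (+-suc x y))))
Adjacent-sum {x} {suc y} southeast = ≤-trans (≤-reflexive (+-suc x y)) (n≤1+n _)

Adjacent-left : ∀ {u v a b} → Adjacent (u , v) (a , b) → u < a → a ≡ suc u × b ≤ v × u + v ≤ a + b
Adjacent-left {x} {y} east _          = refl , ≤-refl , n≤1+n (x + y)
Adjacent-left {x} {suc y} southeast _ = refl , n≤1+n y , ≤-reflexive (+-suc x y)
Adjacent-left west (s≤s lt)           = ⊥-elim (<-irrefl refl (<-trans (n<1+n _) lt))
Adjacent-left north lt                = ⊥-elim (<-irrefl refl lt)
Adjacent-left south lt                = ⊥-elim (<-irrefl refl lt)
Adjacent-left northwest (s≤s lt)      = ⊥-elim (<-irrefl refl (<-trans (n<1+n _) lt))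

Adjacent-below : ∀ {u v a b} → Adjacent (u , v) (a , b) → v < b → b ≡ suc v × a ≤ u × u + v ≤ a + b
Adjacent-below {x} {y} north _           = refl , ≤-refl , ≤-trans (n≤1+n (x + y)) (≤-reflexive (sym (+-suc x y)))
Adjacent-below {suc x} {y} northwest _   = refl , n≤1+n x , ≤-reflexive (sym (+-suc x y))
Adjacent-below east lt                   = ⊥-elim (<-irrefl refl lt)
Adjacent-below west lt                   = ⊥-elim (<-irrefl refl lt)
Adjacent-below south (s≤s lt)            = ⊥-elim (<-irrefl refl (<-trans (n<1+n _) lt))
Adjacent-below southeast (s≤s lt)        = ⊥-elim (<-irrefl refl (<-trans (n<1+n _) lt))

-- Filled triangles absorb adjacent points and triangles

-- A filled cell next to an edge of a filled triangle fills the whole line through it along that edge: each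
-- further cell is completed by one filling rule from its neighbour on the line and a cell of the triangle.
fill-column : ∀ {F} → FillClosed F → ∀ {u y s v} → InTri (tri (suc u) y s) ⊆ F →
              y ≤ v → u + v < s → F (u , v) → ∀ {q} → y ≤ q → u + q < s → F (u , q)
fill-column {F} cl {u} {y} {s} {v} T⊆F y≤v u+v<s Fuv = spread (λ _ → Fuv) up down
  where
  up : ∀ {q} → v ≤ q → (u + q < s → F (u , q)) → u + suc q < s → F (u , suc q)
  up {q} v≤q Fuq lt = close-up cl (Fuq (<-trans (+-monoʳ-< u (n<1+n q)) lt))
                                 (T⊆F (≤-refl , ≤-trans y≤v v≤q , subst (_< s) (+-suc u q) lt))
  down : ∀ {q} → y ≤ q → q < v → (u + suc q < s → F (u , suc q)) → u + q < s → F (u , q)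
  down {q} y≤q q<v Fuq+1 _ = close-corner cl (T⊆F (≤-refl , y≤q , subst (_< s) (+-suc u q) lt)) (Fuq+1 lt)
    where
    lt : u + suc q < s
    lt = ≤-<-trans (+-monoʳ-≤ u q<v) u+v<s

fill-row : ∀ {F} → FillClosed F → ∀ {x v s u} → InTri (tri x (suc v) s) ⊆ F →
           x ≤ u → u + v < s → F (u , v) → ∀ {p} → x ≤ p → p + v < s → F (p , v)
fill-row {F} cl {x} {v} {s} {u} T⊆F x≤u u+v<s Fuv = spread (λ _ → Fuv) up down
  where
  up : ∀ {p} → u ≤ p → (p + v < s → F (p , v)) → suc p + v < s → F (suc p , v)
  up {p} u≤p Fpv lt = close-right cl (Fpv (<-trans (n<1+n _) lt))
                                    (T⊆F (≤-trans x≤u u≤p , ≤-refl , subst (_< s) (sym (+-suc p v)) lt))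
  down : ∀ {p} → x ≤ p → p < u → (suc p + v < s → F (suc p , v)) → p + v < s → F (p , v)
  down {p} x≤p p<u Fp+1v _ = close-corner cl (Fp+1v lt) (T⊆F (x≤p , ≤-refl , subst (_< s) (sym (+-suc p v)) lt))
    where
    lt : suc p + v < s
    lt = ≤-<-trans (+-monoˡ-≤ v p<u) u+v<s

fill-antidiagonal : ∀ {F} → FillClosed F → ∀ {x y s u v} → InTri (tri x y s) ⊆ F →
                    x ≤ u → y ≤ v → u + v ≡ s → F (u , v) →
                    ∀ {p q} → x ≤ p → y ≤ q → p + q ≡ s → F (p , q)
fill-antidiagonal {F} cl {x} {y} {s} {u} {v} T⊆F x≤u y≤v u+v≡s Fuv x≤p = spread {P = P} Pu up down x≤p
  where
  P : ℕ → Set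
  P p = ∀ {q} → y ≤ q → p + q ≡ s → F (p , q)
  Pu : P u
  Pu {q} _ u+q≡s = subst (λ z → F (u , z)) (+-cancelˡ-≡ u v q (trans u+v≡s (sym u+q≡s))) Fuv
  up : ∀ {p} → u ≤ p → P p → P (suc p)
  up {p} u≤p Pp {q} y≤q p+1+q≡s =
    close-right cl (T⊆F (≤-trans x≤u u≤p , y≤q , subst (p + q <_) p+1+q≡s (n<1+n (p + q))))
                   (Pp (m≤n⇒m≤1+n y≤q) (trans (+-suc p q) p+1+q≡s))
  down : ∀ {p} → x ≤ p → p < u → P (suc p) → P p
  down {p} x≤p p<u Pp+1 {q} _ p+q≡s = go q v<q p+q≡s
    where
    v<q : v < q
    v<q = +-cancelˡ-< p v q (≤-trans (+-monoˡ-≤ v p<u) (≤-reflexive (trans u+v≡s (sym p+q≡s))))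
    go : ∀ q → v < q → p + q ≡ s → F (p , q)
    go (suc q) (s≤s v≤q) p+q+1≡s =
      close-up cl (T⊆F (x≤p , ≤-trans y≤v v≤q , subst (p + q <_) p+1+q≡s (n<1+n (p + q))))
                  (Pp+1 (≤-trans y≤v v≤q) p+1+q≡s)
      where
      p+1+q≡s : suc p + q ≡ s
      p+1+q≡s = trans (sym (+-suc p q)) p+q+1≡s

Filled≤ : (Pt → Set) → Triangle → ℕ → Set
Filled≤ F H m = InTri H ⊆ F × side H ≤ m

absorb-left : ∀ {F} → FillClosed F → ∀ {u v y s} → InTri (tri (suc u) y s) ⊆ F → F (u , v) →
              y ≤ v → u + v < s → Filled≤ F (hull (tri (suc u) y s) (pt (u , v))) (suc (side (tri (suc u) y s)))
absorb-left cl {u} {v} {y} {s} T⊆F Fuv y≤v u+v<s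
  rewrite m≥n⇒m⊓n≡n (n≤1+n u) | m≤n⇒m⊓n≡m y≤v | m≥n⇒m⊔n≡m u+v<s = column , suc-∸-≤ s (suc (u + y))
  where
  column : InTri (tri u y s) ⊆ _
  column {w , z} (u≤w , y≤z , w+z<s) with m≤n⇒m<n∨m≡n u≤w
  ... | inj₁ u<w = T⊆F (u<w , y≤z , w+z<s)
  ... | inj₂ refl = fill-column cl T⊆F y≤v u+v<s Fuv y≤z w+z<s

absorb-below : ∀ {F} → FillClosed F → ∀ {u v x s} → InTri (tri x (suc v) s) ⊆ F → F (u , v) →
               x ≤ u → u + v < s → Filled≤ F (hull (tri x (suc v) s) (pt (u , v))) (suc (side (tri x (suc v) s)))
absorb-below cl {u} {v} {x} {s} T⊆F Fuv x≤u u+v<s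
  rewrite m≤n⇒m⊓n≡m x≤u | m≥n⇒m⊓n≡n (n≤1+n v) | m≥n⇒m⊔n≡m u+v<s | +-suc x v =
  row , suc-∸-≤ s (suc (x + v))
  where
  row : InTri (tri x v s) ⊆ _
  row {w , z} (x≤w , v≤z , w+z<s) with m≤n⇒m<n∨m≡n v≤z
  ... | inj₁ v<z = T⊆F (x≤w , v<z , w+z<s)
  ... | inj₂ refl = fill-row cl T⊆F x≤u u+v<s Fuv x≤w w+z<s

absorb-inside : ∀ {F x y s u v} → x ≤ u → y ≤ v → u + v < s → InTri (tri x y s) ⊆ F →
                Filled≤ F (hull (tri x y s) (pt (u , v))) (suc (side (tri x y s)))
absorb-inside {x = x} {y} {s} x≤u y≤v u+v<s T⊆F
  rewrite m≤n⇒m⊓n≡m x≤u | m≤n⇒m⊓n≡m y≤v | m≥n⇒m⊔n≡m u+v<s = T⊆F , n≤1+n (s ∸ (x + y))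

absorb-antidiagonal : ∀ {F} → FillClosed F → ∀ {x y s u v} → InTri (tri x y s) ⊆ F → F (u , v) →
                      x ≤ u → y ≤ v → u + v ≡ s → Filled≤ F (hull (tri x y s) (pt (u , v))) (suc (side (tri x y s)))
absorb-antidiagonal cl {x} {y} {s} T⊆F Fuv x≤u y≤v refl
  rewrite m≤n⇒m⊓n≡m x≤u | m≤n⇒m⊓n≡m y≤v | m≤n⇒m⊔n≡n (n≤1+n s) = grown , suc-∸-≤ s (x + y)
  where
  grown : InTri (tri x y (suc s)) ⊆ _
  grown {w , z} (x≤w , y≤z , w+z≤s) with m≤n⇒m<n∨m≡n (≤-pred w+z≤s)
  ... | inj₁ w+z<s = T⊆F (x≤w , y≤z , w+z<s)
  ... | inj₂ w+z≡s = fill-antidiagonal cl T⊆F x≤u y≤v refl Fuv x≤w y≤z w+z≡s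

absorb-point : ∀ {F} → FillClosed F → ∀ T {p q} → InTri T ⊆ F → F p → InTri T q → Adjacent p q →
               Filled≤ F (hull T (pt p)) (suc (side T))
absorb-point cl (tri x y s) {u , v} {a , b} T⊆F Fuv (x≤a , y≤b , a+b<s) adj with u <? x | v <? y
... | yes u<x | _
  with refl , b≤v , u+v≤a+b ← Adjacent-left adj (<-≤-trans u<x x≤a)
  with refl ← ≤-antisym x≤a u<x
  = absorb-left cl T⊆F Fuv (≤-trans y≤b b≤v) (≤-<-trans u+v≤a+b a+b<s)
... | no u≮x | yes v<y
  with refl , a≤u , u+v≤a+b ← Adjacent-below adj (<-≤-trans v<y y≤b)
  with refl ← ≤-antisym y≤b v<y
  = absorb-below cl T⊆F Fuv (≤-trans x≤a a≤u) (≤-<-trans u+v≤a+b a+b<s)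
... | no u≮x | no v≮y with u + v <? s
...   | yes u+v<s = absorb-inside (≮⇒≥ u≮x) (≮⇒≥ v≮y) u+v<s T⊆F
...   | no u+v≮s  = absorb-antidiagonal cl T⊆F Fuv (≮⇒≥ u≮x) (≮⇒≥ v≮y)
                      (≤-antisym (≤-trans (Adjacent-sum adj) a+b<s) (≮⇒≥ u+v≮s))

record Peeling (x y k : ℕ) (b : Pt) : Set where
  constructor peeling
  field
    x′ y′  : ℕ
    r q    : Pt
    b∈B′   : InTri (triangle x′ y′ (suc k)) b
    q∈B′   : InTri (triangle x′ y′ (suc k)) q
    r~q    : Adjacent r q
    hull≡B : hull (triangle x′ y′ (suc k)) (pt r) ≡ triangle x y (suc (suc k))

-- B′ drops the left column of B if b avoids it, else the bottom row if b avoids it, else (b is the corner)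
-- the hypotenuse; r is then the corner of B, resp. the bottom end of the hypotenuse.
peel : ∀ x y k {b} → InTri (triangle x y (suc (suc k))) b → Peeling x y k b
peel x y k {b₁ , b₂} (x≤b₁ , y≤b₂ , b<s) with x <? b₁ | y <? b₂
... | yes x<b₁ | _ =
  peeling (suc x) y (x , y) (suc x , y) (x<b₁ , y≤b₂ , subst (b₁ + b₂ <_) (sym (+-suc (suc k) (x + y))) b<s)
          (≤-refl , ≤-refl , m<n+m (suc x + y) z<s) east hull≡
  where
  hull≡ : hull (triangle (suc x) y (suc k)) (pt (x , y)) ≡ triangle x y (suc (suc k))
  hull≡ rewrite m≥n⇒m⊓n≡n (n≤1+n x) | ⊓-idem y | m≥n⇒m⊔n≡m (m≤n+m (suc (x + y)) (suc k))
              | +-suc (suc k) (x + y) = refl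
... | no x≮b₁ | yes y<b₂ with refl ← ≤-antisym (≮⇒≥ x≮b₁) x≤b₁ =
  peeling x (suc y) (x , y) (x , suc y) (≤-refl , y<b₂ , subst (b₁ + b₂ <_) (sym bound≡) b<s)
          (≤-refl , ≤-refl , m<n+m (x + suc y) {suc k} z<s) north hull≡
  where
  bound≡ : suc k + (x + suc y) ≡ suc (suc k + (x + y))
  bound≡ = trans (cong (suc k +_) (+-suc x y)) (+-suc (suc k) (x + y))
  hull≡ : hull (triangle x (suc y) (suc k)) (pt (x , y)) ≡ triangle x y (suc (suc k))
  hull≡ rewrite ⊓-idem x | m≥n⇒m⊓n≡n (n≤1+n y) | +-suc x y | m≥n⇒m⊔n≡m (m≤n+m (suc (x + y)) (suc k))
              | +-suc (suc k) (x + y) = refl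
... | no x≮b₁ | no y≮b₂
  with refl ← ≤-antisym (≮⇒≥ x≮b₁) x≤b₁ | refl ← ≤-antisym (≮⇒≥ y≮b₂) y≤b₂ =
  peeling x y (suc k + x , y) (k + x , y) (≤-refl , ≤-refl , m<n+m (x + y) {suc k} z<s)
          (m≤n+m x k , ≤-refl , s≤s (≤-reflexive (+-assoc k x y))) west hull≡
  where
  hull≡ : hull (triangle x y (suc k)) (pt (suc k + x , y)) ≡ triangle x y (suc (suc k))
  hull≡ rewrite m≤n⇒m⊓n≡m (m≤n+m x (suc k)) | ⊓-idem y | +-assoc k x y
              | m≤n⇒m⊔n≡n (n≤1+n (suc k + (x + y))) = refl

absorb-sized : ∀ {F} → FillClosed F → ∀ A k x y {a b} → InTri A ⊆ F → InTri (triangle x y (suc k)) ⊆ F →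
               InTri A a → InTri (triangle x y (suc k)) b → Adjacent b a →
               Filled≤ F (hull A (triangle x y (suc k))) (side A + suc k)
absorb-sized cl A zero x y A⊆F B⊆F a∈A b∈B adj with refl ← InTri-pt⁻ b∈B
  with H⊆F , sideH ← absorb-point cl A A⊆F (B⊆F b∈B) a∈A adj
  = H⊆F , subst (side (hull A (pt (x , y))) ≤_) (+-comm 1 (side A)) sideH
absorb-sized {F} cl A (suc k) x y {a} {b} A⊆F B⊆F a∈A b∈B adj = from (peel x y k b∈B)
  where
  B = triangle x y (suc (suc k))
  from : Peeling x y k b → Filled≤ F (hull A B) (side A + suc (suc k))
  from (peeling x′ y′ r q b∈B′ q∈B′ r~q hull≡B) =
    subst (λ H → Filled≤ F H (side A + suc (suc k))) (trans (hull-assoc A B′ (pt r)) (cong (hull A) hull≡B))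
      (proj₁ grown , ≤-trans (proj₂ grown) (≤-trans (s≤s (proj₂ inner)) (≤-reflexive (sym (+-suc (side A) (suc k))))))
    where
    B′ = triangle x′ y′ (suc k)
    B′⊆B : InTri B′ ⊆ InTri B
    B′⊆B = subst (λ H → InTri B′ ⊆ InTri H) hull≡B (InTri-hullˡ B′ (pt r))
    r∈B : InTri B r
    r∈B = subst (λ H → InTri H r) hull≡B (InTri-hullʳ B′ (pt r) (InTri-pt r))
    inner : Filled≤ F (hull A B′) (side A + suc k)
    inner = absorb-sized cl A k x′ y′ A⊆F (B⊆F ∘ B′⊆B) a∈A b∈B′ adj
    grown : Filled≤ F (hull (hull A B′) (pt r)) (suc (side (hull A B′)))
    grown = absorb-point cl (hull A B′) (proj₁ inner) (B⊆F r∈B) (InTri-hullʳ A B′ q∈B′) r~q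

absorb-triangle : ∀ {F} → FillClosed F → ∀ A B {a b} → NonEmpty B → InTri A ⊆ F → InTri B ⊆ F →
                  InTri A a → InTri B b → Adjacent b a → Filled≤ F (hull A B) (side A + side B)
absorb-triangle {F} cl A (tri x y s) ne A⊆F B⊆F a∈A b∈B adj with k , refl ← NonEmpty⇒sized {x} {y} ne =
  subst (λ m → Filled≤ F (hull A (triangle x y (suc k))) (side A + m)) (sym (side-triangle x y (suc k)))
    (absorb-sized cl A k x y A⊆F B⊆F a∈A b∈B adj)

-- Shifted sums of bases are bases

basis-length : ∀ {n C} → TriangleBasis n C → length C ≡ n
basis-length ((_ , |C|≡n , _) , _) = |C|≡n

InT⊆Fill⇒≤ : ∀ {N n C} → All (InT n) C → InT N ⊆ Fill C → N ≤ n
InT⊆Fill⇒≤ {zero} _ _ = z≤n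
InT⊆Fill⇒≤ {suc N} {n} C⊆Tn TN⊆C =
  subst (λ z → suc z ≤ n) (+-identityʳ N) (Fill⊆InT C⊆Tn (TN⊆C {N , 0} (s≤s (≤-reflexive (+-identityʳ N)))))

-- Uniqueness of C gives n ≤ N, and the filling of C staying inside T_n gives N ≤ n.
basis-of-cover : ∀ {n N C M} → IsConfig n C → C ≋ M → length M ≡ N → InT N ⊆ Fill M → TriangleBasis n C
basis-of-cover {C = C} {M} config@(uniq , refl , C⊆Tn) C≋M refl TM⊆M =
  config , λ p → mk⇔ (Fill⊆InT C⊆Tn) (λ p∈Tn → TM⊆C (subst (λ N → InT N p) (sym |M|≡|C|) p∈Tn))
  where
  TM⊆C : InT (length M) ⊆ Fill C
  TM⊆C p∈TM = Fill-mono (Equivalence.from (C≋M _)) (TM⊆M p∈TM)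
  |M|≡|C| : length M ≡ length C
  |M|≡|C| = ≤-antisym (InT⊆Fill⇒≤ C⊆Tn TM⊆C) (Unique-⊆⇒length≤ uniq (Equivalence.to (C≋M _)))

basis-translate : ∀ {m D P} a b → TriangleBasis m D → (_∈ map ((a , b) ⊕_) D) ⊆ (_∈ P) →
                  InTri (triangle a b m) ⊆ Fill P
basis-translate {m} {D} a b (_ , D-spans) D+v⊆P {u , v} p∈T@(a≤u , b≤v , _)
  with u′ , refl ← m≤n⇒∃[o]m+o≡n a≤u | v′ , refl ← m≤n⇒∃[o]m+o≡n b≤v =
  Fill-mono D+v⊆P (Fill-translate (a , b) D (Equivalence.from (D-spans (u′ , v′)) (InTri-triangle⇒InT p∈T)))

translates-fill-hull : ∀ {m₁ m₂ D₁ D₂ M a₁ b₁ a₂ b₂ p q} → TriangleBasis m₁ D₁ → TriangleBasis m₂ D₂ →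
                       1 ≤ m₂ →
                       (_∈ map ((a₁ , b₁) ⊕_) D₁) ⊆ (_∈ M) → (_∈ map ((a₂ , b₂) ⊕_) D₂) ⊆ (_∈ M) →
                       InTri (triangle a₁ b₁ m₁) p → InTri (triangle a₂ b₂ m₂) q → Adjacent q p →
                       InTri (hull (triangle a₁ b₁ m₁) (triangle a₂ b₂ m₂)) ⊆ Fill M
translates-fill-hull {m₁} {m₂} {a₁ = a₁} {b₁} {a₂} {b₂} basis₁ basis₂ 1≤m₂ D₁⊆M D₂⊆M p∈A q∈B q~p =
  proj₁ (absorb-triangle (Fill-closed _) (triangle a₁ b₁ m₁) (triangle a₂ b₂ m₂) (m<n+m (a₂ + b₂) 1≤m₂)
           (basis-translate a₁ b₁ basis₁ D₁⊆M) (basis-translate a₂ b₂ basis₂ D₂⊆M) p∈A q∈B q~p)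

vSum-fills : ∀ {n₁ n₂ C₁ C₂} h → 1 ≤ n₁ → 1 ≤ n₂ → h ≤ n₁ →
             TriangleBasis n₁ C₁ → TriangleBasis n₂ C₂ → InT (n₁ + n₂) ⊆ Fill (vSum C₁ C₂ h)
vSum-fills {n₁} {suc k} {C₁} {C₂} h 1≤n₁ 1≤n₂ h≤n₁ basis₁ basis₂ p∈T =
  hull⊆ h h≤n₁ (InT⊆InTri _ (m⊓n≤n (suc k) 0) (m⊓n≤m 0 h)
                  (≤-trans (≤-reflexive (cong (n₁ +_) (sym (+-identityʳ (suc k))))) (m≤m⊔n _ _)) p∈T)
  where
  C₁⊆ : ∀ {h} → (_∈ map ((suc k , 0) ⊕_) C₁) ⊆ (_∈ vSum C₁ C₂ h)
  C₁⊆ = ∈-++⁺ˡ ∘ subst (λ z → _ ∈ map ((z , 0) ⊕_) C₁) (sym (basis-length basis₂))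
  hull⊆ : ∀ h → h ≤ n₁ → InTri (hull (triangle (suc k) 0 n₁) (triangle 0 h (suc k))) ⊆ Fill (vSum C₁ C₂ h)
  hull⊆ zero _ = translates-fill-hull basis₁ basis₂ 1≤n₂ C₁⊆ (∈-++⁺ʳ _)
                   (≤-refl , z≤n , m<n+m (suc k + 0) 1≤n₁) (z≤n , z≤n , n<1+n (k + 0)) east
  hull⊆ (suc h′) h≤n₁ = translates-fill-hull basis₁ basis₂ 1≤n₂ C₁⊆ (∈-++⁺ʳ _)
                          (≤-refl , z≤n , p∈A) (z≤n , ≤-refl , n<1+n (k + suc h′)) southeast
    where
    open ≤-Reasoning
    p∈A : suc k + h′ < n₁ + (suc k + 0)
    p∈A = begin-strict
      suc k + h′       ≡⟨ +-comm (suc k) h′ ⟩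
      h′ + suc k       <⟨ +-monoˡ-< (suc k) h≤n₁ ⟩
      n₁ + suc k       ≡⟨ cong (n₁ +_) (sym (+-identityʳ (suc k))) ⟩
      n₁ + (suc k + 0) ∎

hSum-fills : ∀ {n₁ n₂ C₁ C₂} h → 1 ≤ n₁ → 1 ≤ n₂ → h ≤ n₁ →
             TriangleBasis n₁ C₁ → TriangleBasis n₂ C₂ → InT (n₁ + n₂) ⊆ Fill (hSum C₁ C₂ h)
hSum-fills {n₁} {suc k} {C₁} {C₂} h 1≤n₁ 1≤n₂ h≤n₁ basis₁ basis₂ p∈T =
  hull⊆ h h≤n₁ (InT⊆InTri _ (m⊓n≤m 0 h) (m⊓n≤n (suc k) 0) (m≤m⊔n _ _) p∈T)
  where
  C₁⊆ : ∀ {h} → (_∈ map ((0 , suc k) ⊕_) C₁) ⊆ (_∈ hSum C₁ C₂ h)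
  C₁⊆ = ∈-++⁺ˡ ∘ subst (λ z → _ ∈ map ((0 , z) ⊕_) C₁) (sym (basis-length basis₂))
  hull⊆ : ∀ h → h ≤ n₁ → InTri (hull (triangle 0 (suc k) n₁) (triangle h 0 (suc k))) ⊆ Fill (hSum C₁ C₂ h)
  hull⊆ zero _ = translates-fill-hull basis₁ basis₂ 1≤n₂ C₁⊆ (∈-++⁺ʳ _)
                   (z≤n , ≤-refl , m<n+m (suc k) 1≤n₁) (z≤n , z≤n , s≤s (m≤m+n k 0)) north
  hull⊆ (suc h′) h≤n₁ = translates-fill-hull basis₁ basis₂ 1≤n₂ C₁⊆ (∈-++⁺ʳ _)
                          (z≤n , ≤-refl , +-monoˡ-< (suc k) h≤n₁) (≤-refl , z≤n , q∈B) northwest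
    where
    open ≤-Reasoning
    q∈B : suc h′ + k < suc k + (suc h′ + 0)
    q∈B = begin-strict
      suc h′ + k           ≡⟨ +-comm (suc h′) k ⟩
      k + suc h′           <⟨ n<1+n (k + suc h′) ⟩
      suc k + suc h′       ≡⟨ cong (suc k +_) (sym (+-identityʳ (suc h′))) ⟩
      suc k + (suc h′ + 0) ∎

dSum-fills : ∀ {n₁ n₂ C₁ C₂} h → 1 ≤ n₁ → 1 ≤ n₂ → h ≤ n₁ →
             TriangleBasis n₁ C₁ → TriangleBasis n₂ C₂ → InT (n₁ + n₂) ⊆ Fill (dSum C₁ C₂ h)
dSum-fills {n₁} {suc k} {C₁} {C₂} h 1≤n₁ 1≤n₂ h≤n₁ basis₁ basis₂ p∈T =
  hull⊆ (n₁ ∸ h) h (m∸n+n≡m h≤n₁) (InT⊆InTri _ z≤n (m⊓n≤m 0 h) (≤-trans N≤ (m≤n⊔m _ _)) p∈T)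
  where
  N≤ : n₁ + suc k ≤ suc k + (n₁ ∸ h + h)
  N≤ = ≤-reflexive (trans (+-comm n₁ (suc k)) (cong (suc k +_) (sym (m∸n+n≡m h≤n₁))))
  C₁⊆ : ∀ {h} → (_∈ map ((0 , 0) ⊕_) C₁) ⊆ (_∈ dSum C₁ C₂ h)
  C₁⊆ = ∈-++⁺ˡ ∘ subst (_ ∈_) (map-id C₁)
  C₂⊆ : ∀ {d h} → d + h ≡ n₁ → (_∈ map ((d , h) ⊕_) C₂) ⊆ (_∈ dSum C₁ C₂ h)
  C₂⊆ {d} {h} d+h≡n₁ = ∈-++⁺ʳ C₁ ∘ subst (λ z → _ ∈ map ((z , h) ⊕_) C₂) d≡
    where
    d≡ : d ≡ length C₁ ∸ h
    d≡ = trans (sym (m+n∸n≡m d h)) (cong (_∸ h) (trans d+h≡n₁ (sym (basis-length basis₁))))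
  hull⊆ : ∀ d h → d + h ≡ n₁ → InTri (hull (triangle 0 0 n₁) (triangle d h (suc k))) ⊆ Fill (dSum C₁ C₂ h)
  hull⊆ (suc d) h d+h≡n₁ = translates-fill-hull basis₁ basis₂ 1≤n₂ C₁⊆ (C₂⊆ d+h≡n₁)
                             (z≤n , z≤n , ≤-reflexive (trans d+h≡n₁ (sym (+-identityʳ n₁))))
                             (≤-refl , ≤-refl , m<n+m (suc d + h) z<s) west
  hull⊆ zero (suc h′) h≡n₁ = translates-fill-hull basis₁ basis₂ 1≤n₂ C₁⊆ (C₂⊆ h≡n₁)
                               (z≤n , z≤n , ≤-reflexive (trans h≡n₁ (sym (+-identityʳ n₁))))
                               (z≤n , ≤-refl , m<n+m (suc h′) z<s) south
  hull⊆ zero zero 0≡n₁ = ⊥-elim (<-irrefl 0≡n₁ 1≤n₁)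

ShiftedSum : List Pt → List Pt → List Pt → ℕ → Set
ShiftedSum C C₁ C₂ h = C ≋ vSum C₁ C₂ h ⊎ C ≋ hSum C₁ C₂ h ⊎ C ≋ dSum C₁ C₂ h

length-sum : ∀ {n₁ n₂} (xs : List Pt) (g : Pt → Pt) {ys : List Pt} → length xs ≡ n₁ → length ys ≡ n₂ →
             length (xs ++ map g ys) ≡ n₁ + n₂
length-sum xs g {ys} |xs| |ys| = trans (length-++ xs) (cong₂ _+_ |xs| (trans (length-map g ys) |ys|))

shifted-sum-basis : ∀ {n n₁ n₂ C C₁ C₂ h} → IsConfig n C → 1 ≤ n₁ → 1 ≤ n₂ → h ≤ n₁ →
                    TriangleBasis n₁ C₁ → TriangleBasis n₂ C₂ → ShiftedSum C C₁ C₂ h → TriangleBasis n C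
shifted-sum-basis {n₁ = n₁} {C = C} {C₁} {C₂} {h} config 1≤n₁ 1≤n₂ h≤n₁ basis₁ basis₂ = by-kind
  where
  |C₂| = basis-length basis₂
  |C₁+v| : ∀ v → length (map (v ⊕_) C₁) ≡ n₁
  |C₁+v| v = trans (length-map (v ⊕_) C₁) (basis-length basis₁)
  by-kind : ShiftedSum C C₁ C₂ h → TriangleBasis _ C
  by-kind (inj₁ C≋)        = basis-of-cover config C≋ (length-sum (map _ C₁) _ (|C₁+v| _) |C₂|)
                               (vSum-fills h 1≤n₁ 1≤n₂ h≤n₁ basis₁ basis₂)
  by-kind (inj₂ (inj₁ C≋)) = basis-of-cover config C≋ (length-sum (map _ C₁) _ (|C₁+v| _) |C₂|)
                               (hSum-fills h 1≤n₁ 1≤n₂ h≤n₁ basis₁ basis₂)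
  by-kind (inj₂ (inj₂ C≋)) = basis-of-cover config C≋ (length-sum C₁ _ (basis-length basis₁) |C₂|)
                               (dSum-fills h 1≤n₁ 1≤n₂ h≤n₁ basis₁ basis₂)

singleton-basis : ∀ {n p} → IsConfig n [ p ] → TriangleBasis n [ p ]
singleton-basis {p = zero , zero} config@(_ , refl , _) = basis-of-cover config (λ _ → mk⇔ id id) refl origin
  where
  origin : InT 1 ⊆ Fill [ (0 , 0) ]
  origin {zero , zero} _ = base (here refl)
  origin {suc x , y} (s≤s ())
  origin {zero , suc y} (s≤s ())
singleton-basis {p = suc x , y}    (_ , refl , s≤s () ∷ [])
singleton-basis {p = zero , suc y} (_ , refl , s≤s () ∷ [])

-- Blocks

record Block : Set where
  field
    points   : List Pt
    shape    : Triangle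
    nonempty : NonEmpty shape
    inside   : All (InTri shape) points
    spanned  : InTri shape ⊆ Fill points
    side≤    : side shape ≤ length points
open Block public

data Origin (b : Block) : Set where
  single : length (points b) ≡ 1 → Origin b
  merged : (b₁ b₂ : Block) → points b ≡ points b₁ ++ points b₂ → shape b ≡ hull (shape b₁) (shape b₂) →
           side (shape b) ≤ side (shape b₁) + side (shape b₂) → Origin b

singleton : Pt → ∃ Origin
singleton p = block , single refl
  where
  block : Block
  block = record
    { points   = [ p ]
    ; shape    = pt p
    ; nonempty = n<1+n _
    ; inside   = InTri-pt p ∷ []
    ; spanned  = λ q∈p → base (here (InTri-pt⁻ q∈p))
    ; side≤    = ≤-reflexive (side-triangle (proj₁ p) (proj₂ p) 1)
    }

fuse : (b₁ b₂ : Block) → ∀ {a b} → InTri (shape b₁) a → InTri (shape b₂) b → Adjacent b a → ∃ Origin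
fuse b₁ b₂ a∈A b∈B b~a = block , merged b₁ b₂ refl refl (proj₂ hull-filled)
  where
  A = shape b₁
  B = shape b₂
  hull-filled : Filled≤ (Fill (points b₁ ++ points b₂)) (hull A B) (side A + side B)
  hull-filled = absorb-triangle (Fill-closed _) A B (nonempty b₂)
                  (Fill-mono ∈-++⁺ˡ ∘ spanned b₁) (Fill-mono (∈-++⁺ʳ _) ∘ spanned b₂) a∈A b∈B b~a
  block : Block
  block = record
    { points   = points b₁ ++ points b₂
    ; shape    = hull A B
    ; nonempty = hull-nonempty A B (nonempty b₁)
    ; inside   = ++⁺ (All.map (InTri-hullˡ A B) (inside b₁)) (All.map (InTri-hullʳ A B) (inside b₂))
    ; spanned  = proj₁ hull-filled
    ; side≤    = ≤-trans (proj₂ hull-filled)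
                   (≤-trans (+-mono-≤ (side≤ b₁) (side≤ b₂)) (≤-reflexive (sym (length-++ (points b₁)))))
    }

allPoints : List (∃ Origin) → List Pt
allPoints []            = []
allPoints ((b , _) ∷ F) = points b ++ allPoints F

allPoints-singletons : ∀ C → allPoints (map singleton C) ≡ C
allPoints-singletons []      = refl
allPoints-singletons (p ∷ C) = cong (p ∷_) (allPoints-singletons C)

allPoints-↭ : ∀ {F G} → F ↭ G → allPoints F ↭ allPoints G
allPoints-↭ ↭.refl                       = ↭-refl
allPoints-↭ (prep (b , _) F↭G)           = ++⁺ˡ (points b) (allPoints-↭ F↭G)
allPoints-↭ (swap (b , _) (c , _) F↭G)   =
  ↭-trans (++⁺ˡ (points b) (++⁺ˡ (points c) (allPoints-↭ F↭G))) (shifts (points b) (points c))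
allPoints-↭ (↭.trans F↭G G↭H)            = ↭-trans (allPoints-↭ F↭G) (allPoints-↭ G↭H)

covers : Pt → ∃ Origin → Set
covers p (b , _) = InTri (shape b) p

allPoints-covered : ∀ F {p} → p ∈ allPoints F → Any (covers p) F
allPoints-covered ((b , _) ∷ F) p∈ with ∈-++⁻ (points b) p∈
... | inj₁ p∈b = here (All.lookup (inside b) p∈b)
... | inj₂ p∈F = there (allPoints-covered F p∈F)

points-⊆-allPoints : ∀ {c F} → c ∈ F → (_∈ points (proj₁ c)) ⊆ (_∈ allPoints F)
points-⊆-allPoints (here refl) = ∈-++⁺ˡ
points-⊆-allPoints {F = (b , _) ∷ _} (there c∈F) = ∈-++⁺ʳ (points b) ∘ points-⊆-allPoints c∈F

-- A basis splits at its last merge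

ShiftedSumOfBases : List Pt → Set
ShiftedSumOfBases C = ∃[ n₁ ] ∃[ n₂ ] ∃[ C₁ ] ∃[ C₂ ] ∃[ h ]
  (1 ≤ n₁ × 1 ≤ n₂ × TriangleBasis n₁ C₁ × TriangleBasis n₂ C₂ × h ≤ n₁ × ShiftedSum C C₁ C₂ h)

normalise-basis : ∀ {x y l} (g : List Pt) → Unique g → length g ≡ l → All (InTri (triangle x y l)) g →
                  InTri (triangle x y l) ⊆ Fill g → TriangleBasis l (map (unshift (x , y)) g)
normalise-basis {x} {y} {l} g uniq |g| g⊆T T⊆g =
  (map⁻ (subst Unique (sym shift-back) uniq) , trans (length-map _ g) |g| , map⁺ (All.map InT-unshift g⊆T)) ,
  λ { (u , v) → mk⇔ (to u v) (from u v) }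
  where
  D = map (unshift (x , y)) g
  T = triangle x y l
  shift-back : map ((x , y) ⊕_) D ≡ g
  shift-back = shift-unshift g⊆T
  InT-unshift : ∀ {p} → InTri T p → InT l (unshift (x , y) p)
  InT-unshift {u , v} p∈T@(x≤u , y≤v , _) = InTri-triangle⇒InT (subst (InTri T) (sym (⊕-unshift x≤u y≤v)) p∈T)
  to : ∀ u v → Fill D (u , v) → InT l (u , v)
  to u v q∈D = InTri-triangle⇒InT (Fill⊆InTri g⊆T (subst (λ h → Fill h (x + u , y + v)) shift-back
                                                        (Fill-translate (x , y) D q∈D)))
  from : ∀ u v → InT l (u , v) → Fill D (u , v)
  from u v q∈T = Fill-untranslate x y D (subst (λ h → Fill h (x + u , y + v)) (sym shift-back)
                                                (T⊆g (InT⇒InTri-triangle q∈T)))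

exact-block-basis : (b : Block) → Unique (points b) → side (shape b) ≡ length (points b) →
  let x = left (shape b) ; y = bottom (shape b) ; D = map (unshift (x , y)) (points b) in
  shape b ≡ triangle x y (length (points b)) × TriangleBasis (length (points b)) D × map ((x , y) ⊕_) D ≡ points b
exact-block-basis b uniq side≡ =
  shape≡ , normalise-basis (points b) uniq refl b⊆T (subst (λ t → InTri t ⊆ Fill (points b)) shape≡ (spanned b)) ,
  shift-unshift b⊆T
  where
  shape≡ = trans (NonEmpty⇒triangle (shape b) (nonempty b)) (cong (triangle _ _) side≡)
  b⊆T = subst (λ t → All (InTri t) (points b)) shape≡ (inside b)

-- The first triangle reaches the hypotenuse of T_{l₁+l₂}; this forces the corners into a shifted-sum position.
classify-ordered : ∀ {C l₁ l₂ x₁ y₁ x₂ y₂ D₁ D₂} → TriangleBasis l₁ D₁ → TriangleBasis l₂ D₂ →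
                   1 ≤ l₁ → 1 ≤ l₂ → x₁ ≡ 0 ⊎ x₂ ≡ 0 → y₁ ≡ 0 ⊎ y₂ ≡ 0 → x₁ + y₁ ≡ l₂ → x₂ + y₂ ≤ l₁ →
                   C ≋ (map ((x₁ , y₁) ⊕_) D₁ ++ map ((x₂ , y₂) ⊕_) D₂) → ShiftedSumOfBases C
classify-ordered _ _ _ 1≤l₂ (inj₁ refl) (inj₁ refl) 0≡l₂ _ _ = ⊥-elim (<-irrefl 0≡l₂ 1≤l₂)
classify-ordered basis₁ basis₂@((_ , refl , _) , _) 1≤l₁ 1≤l₂ (inj₁ refl) (inj₂ refl) refl x₂+0≤l₁ C≋ =
  _ , _ , _ , _ , _ , 1≤l₁ , 1≤l₂ , basis₁ , basis₂ , ≤-trans (m≤m+n _ 0) x₂+0≤l₁ , inj₂ (inj₁ C≋)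
classify-ordered {x₁ = x₁} basis₁ basis₂@((_ , refl , _) , _) 1≤l₁ 1≤l₂ (inj₂ refl) (inj₁ refl) x₁+0≡l₂ y₂≤l₁ C≋
  with refl ← trans (sym (+-identityʳ x₁)) x₁+0≡l₂ =
  _ , _ , _ , _ , _ , 1≤l₁ , 1≤l₂ , basis₁ , basis₂ , y₂≤l₁ , inj₁ C≋
classify-ordered {C} {x₁ = x₁} {y₁} {D₁ = D₁} {D₂} basis₁ basis₂@((_ , refl , _) , _) 1≤l₁ 1≤l₂
                 (inj₂ refl) (inj₂ refl) x₁+y₁≡l₂ _ C≋ =
  _ , _ , _ , _ , y₁ , 1≤l₂ , 1≤l₁ , basis₂ , basis₁ , subst (y₁ ≤_) x₁+y₁≡l₂ (m≤n+m y₁ x₁) ,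
  inj₂ (inj₂ (subst (C ≋_) (cong₂ _++_ (map-id D₂) (cong (λ z → map ((z , y₁) ⊕_) D₁) x₁≡))
                          (≋-swap (map ((x₁ , y₁) ⊕_) D₁) _ C≋)))
  where
  x₁≡ : x₁ ≡ length D₂ ∸ y₁
  x₁≡ = trans (sym (m+n∸n≡m x₁ y₁)) (cong (_∸ y₁) x₁+y₁≡l₂)

classify : ∀ {C l₁ l₂ x₁ y₁ x₂ y₂ D₁ D₂} → TriangleBasis l₁ D₁ → TriangleBasis l₂ D₂ → 1 ≤ l₁ → 1 ≤ l₂ →
           hull (triangle x₁ y₁ l₁) (triangle x₂ y₂ l₂) ≡ tri 0 0 (l₁ + l₂) →
           C ≋ (map ((x₁ , y₁) ⊕_) D₁ ++ map ((x₂ , y₂) ⊕_) D₂) → ShiftedSumOfBases C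
classify {l₁ = l₁} {l₂} {x₁} {y₁} {x₂} {y₂} {D₁} {D₂} basis₁ basis₂ 1≤l₁ 1≤l₂ hull≡ C≋
  with ⊓≡0 x₁ x₂ (cong left hull≡) | ⊓≡0 y₁ y₂ (cong bottom hull≡) | ⊔-sel s₁ s₂
  where
  s₁ = l₁ + (x₁ + y₁)
  s₂ = l₂ + (x₂ + y₂)
... | x≡0 | y≡0 | inj₁ s≡s₁ =
  classify-ordered basis₁ basis₂ 1≤l₁ 1≤l₂ x≡0 y≡0 (+-cancelˡ-≡ l₁ (x₁ + y₁) l₂ (trans (sym s≡s₁) s≡))
    (+-cancelˡ-≤ l₂ (x₂ + y₂) l₁ (subst (l₂ + (x₂ + y₂) ≤_) (trans s≡ (+-comm l₁ l₂)) (m≤n⊔m _ _))) C≋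
  where
  s≡ = cong bound hull≡
... | x≡0 | y≡0 | inj₂ s≡s₂ =
  classify-ordered basis₂ basis₁ 1≤l₂ 1≤l₁ (⊎-swap x≡0) (⊎-swap y≡0)
    (+-cancelˡ-≡ l₂ (x₂ + y₂) l₁ (trans (sym s≡s₂) (trans s≡ (+-comm l₁ l₂))))
    (+-cancelˡ-≤ l₁ (x₁ + y₁) l₂ (subst (l₁ + (x₁ + y₁) ≤_) s≡ (m≤m⊔n _ _)))
    (≋-swap (map ((x₁ , y₁) ⊕_) D₁) _ C≋)
  where
  s≡ = cong bound hull≡

-- The side bound of the merge is tight here, so each half has side equal to its number of points.
merged-basis : ∀ {C} (b₁ b₂ : Block) → Unique (points b₁ ++ points b₂) →
               hull (shape b₁) (shape b₂) ≡ tri 0 0 (length (points b₁ ++ points b₂)) →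
               length (points b₁ ++ points b₂) ≤ side (shape b₁) + side (shape b₂) →
               C ≋ (points b₁ ++ points b₂) → ShiftedSumOfBases C
merged-basis {C} b₁ b₂ uniq hull≡ |g|≤sides C≋
  with side₁≡ , side₂≡ ← tight-+ (side≤ b₁) (side≤ b₂)
                            (subst (_≤ side (shape b₁) + side (shape b₂)) (length-++ (points b₁)) |g|≤sides)
  with uniq₁ , uniq₂ ← Unique-++⁻ (points b₁) uniq
  with shape₁≡ , basis₁ , shift₁ ← exact-block-basis b₁ uniq₁ side₁≡
  with shape₂≡ , basis₂ , shift₂ ← exact-block-basis b₂ uniq₂ side₂≡
  = classify basis₁ basis₂
      (subst (1 ≤_) side₁≡ (m<n⇒0<n∸m (nonempty b₁))) (subst (1 ≤_) side₂≡ (m<n⇒0<n∸m (nonempty b₂)))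
      (trans (cong₂ hull (sym shape₁≡) (sym shape₂≡)) (trans hull≡ (cong (tri 0 0) (length-++ (points b₁)))))
      (subst (C ≋_) (sym (cong₂ _++_ shift₁ shift₂)) C≋)

module Decomposition {n C} (config : IsConfig n C) (Tn⊆C : InT n ⊆ Fill C) (2≤n : 2 ≤ n) where

  C⊆Tn : All (InT n) C
  C⊆Tn = proj₂ (proj₂ config)

  |C|≡n : length C ≡ n
  |C|≡n = proj₁ (proj₂ config)

  origin∈Tn : InT n (0 , 0)
  origin∈Tn = <-≤-trans z<s 2≤n

  data Window : Set where
    horizontal vertical antidiagonal : Window

  cells : Window → ℕ → ℕ → Pt × Pt
  cells horizontal   x y = (x , y) , (suc x , y)
  cells vertical     x y = (x , y) , (x , suc y)
  cells antidiagonal x y = (suc x , y) , (x , suc y)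

  cells-adjacent : ∀ w x y → Adjacent (proj₂ (cells w x y)) (proj₁ (cells w x y))
  cells-adjacent horizontal   _ _ = west
  cells-adjacent vertical     _ _ = south
  cells-adjacent antidiagonal _ _ = southeast

  -- The bounds x , y < n make touching decidable; the cells read by a rule inside T_n satisfy them.
  TouchAt : List (∃ Origin) → ℕ → ℕ → Set
  TouchAt F x y = ∃[ w ] Any₂ (covers (proj₁ (cells w x y))) (covers (proj₂ (cells w x y))) F

  Touching : List (∃ Origin) → Set
  Touching F = ∃ λ x → x < n × ∃ λ y → y < n × TouchAt F x y

  touchAt? : ∀ F x y → Dec (TouchAt F x y)
  touchAt? F x y with touch-in horizontal | touch-in vertical | touch-in antidiagonal
    where
    touch-in : ∀ w → Dec (Any₂ (covers (proj₁ (cells w x y))) (covers (proj₂ (cells w x y))) F)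
    touch-in w = any₂? (λ { (b , _) → InTri? (shape b) _ }) (λ { (b , _) → InTri? (shape b) _ }) F
  ... | yes two | _       | _       = yes (horizontal , two)
  ... | no _    | yes two | _       = yes (vertical , two)
  ... | no _    | no _    | yes two = yes (antidiagonal , two)
  ... | no ¬h   | no ¬v   | no ¬a   = no λ
    { (horizontal , two)   → ¬h two
    ; (vertical , two)     → ¬v two
    ; (antidiagonal , two) → ¬a two
    }

  touching? : ∀ F → Dec (Touching F)
  touching? F = anyUpTo? (λ x → anyUpTo? (touchAt? F x) n) n

  Covered : List (∃ Origin) → Pt → Set
  Covered F p = InT n p × Any (covers p) F

  rule-covered : ∀ F → ¬ Touching F → ∀ w {x y r} → InT n (x , y) →
         (∀ t → InTri t (proj₁ (cells w x y)) → InTri t (proj₂ (cells w x y)) → InTri t r) →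
         Any (covers (proj₁ (cells w x y))) F → Any (covers (proj₂ (cells w x y))) F → Any (covers r) F
  rule-covered F ¬touch w {x} {y} x+y<n close p∈F q∈F with Any₂-or-Any∩ p∈F q∈F
  ... | inj₁ two  = ⊥-elim (¬touch (x , ≤-<-trans (m≤m+n x y) x+y<n , y , ≤-<-trans (m≤n+m y x) x+y<n , w , two))
  ... | inj₂ both = Any.map (λ { {b , _} (p∈b , q∈b) → close (shape b) p∈b q∈b }) both

  Covered-closed : ∀ F → ¬ Touching F → FillClosed (Covered F)
  Covered-closed F ¬touch = record
    { close-up     = λ { {x} {y} (x+y<n , p) (x+1+y<n , q) →
        subst (_< n) (sym (+-suc x y)) x+1+y<n ,
        rule-covered F ¬touch horizontal x+y<n (λ t → close-up (InTri-closed t)) p q }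
    ; close-right  = λ { {x} {y} (x+y<n , p) (x+y+1<n , q) →
        subst (_< n) (+-suc x y) x+y+1<n ,
        rule-covered F ¬touch vertical x+y<n (λ t → close-right (InTri-closed t)) p q }
    ; close-corner = λ { {x} {y} (x+1+y<n , p) (_ , q) →
        let x+y<n = <-trans (n<1+n (x + y)) x+1+y<n in
        x+y<n , rule-covered F ¬touch antidiagonal x+y<n (λ t → close-corner (InTri-closed t)) p q }
    }

  covered : ∀ F → ¬ Touching F → allPoints F ↭ C → InT n ⊆ Covered F
  covered F ¬touch F↭C p∈Tn = Fill-least (Covered-closed F ¬touch) C⊆Covered (Tn⊆C p∈Tn)
    where
    C⊆Covered : (_∈ C) ⊆ Covered F
    C⊆Covered p∈C = All.lookup C⊆Tn p∈C , allPoints-covered F (∈-resp-↭ (↭-sym F↭C) p∈C)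

  -- The block at the origin spans T_n: if its hypotenuse stopped short of n, the cell just right of its
  -- bottom-right corner would be covered by a different block touching it.
  origin-block-bound : ∀ F → ¬ Touching F → allPoints F ↭ C → ∀ {c} → c ∈ F →
                       ∀ s → shape (proj₁ c) ≡ tri 0 0 s → 0 < s → s ≡ n
  origin-block-bound F ¬touch F↭C {c@(b , _)} c∈F (suc s′) shape≡ _ = ≤-antisym s≤n n≤s
    where
    b⊆C : InTri (shape b) ⊆ Fill C
    b⊆C = Fill-mono (∈-resp-↭ F↭C ∘ points-⊆-allPoints c∈F) ∘ spanned b
    s′∈b : covers (s′ , 0) c
    s′∈b = subst (λ t → InTri t (s′ , 0)) (sym shape≡) (z≤n , z≤n , s≤s (≤-reflexive (+-identityʳ s′)))
    s∉b : ¬ covers (suc s′ , 0) c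
    s∉b s∈b with _ , _ , s+0<s ← subst (λ t → InTri t (suc s′ , 0)) shape≡ s∈b =
      <-irrefl (+-identityʳ (suc s′)) s+0<s
    s≤n : suc s′ ≤ n
    s≤n = subst (_< n) (+-identityʳ s′) (Fill⊆InT C⊆Tn (b⊆C s′∈b))
    n≤s : n ≤ suc s′
    n≤s = ≮⇒≥ λ s<n → ¬touch (s′ , s≤n , 0 , origin∈Tn , horizontal ,
            Any₂-separate (lose c∈F (s′∈b , s∉b))
              (proj₂ (covered F ¬touch F↭C (subst (_< n) (sym (+-identityʳ (suc s′))) s<n))))

  origin-block-shape : ∀ F → ¬ Touching F → allPoints F ↭ C → ∀ {c} → c ∈ F → covers (0 , 0) c →
                       shape (proj₁ c) ≡ tri 0 0 n
  origin-block-shape F ¬touch F↭C {b , _} c∈F 0∈b =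
    trans shape≡ (cong (tri 0 0) (origin-block-bound F ¬touch F↭C c∈F _ shape≡ (subst NonEmpty shape≡ (nonempty b))))
    where
    shape≡ = InTri-origin (shape b) 0∈b

  from-apart-blocks : ∀ F → ¬ Touching F → allPoints F ↭ C → ShiftedSumOfBases C
  from-apart-blocks F ¬touch F↭C
    with c@(b , origin) , c∈F , 0∈b ← find (proj₂ (covered F ¬touch F↭C origin∈Tn))
    with R , F↭c∷R ← ∈-↭ c∈F
    = from-origin origin
    where
    shape≡ : shape b ≡ tri 0 0 n
    shape≡ = origin-block-shape F ¬touch F↭C c∈F 0∈b
    b↭C : points b ↭ C
    b↭C = prefix-↭ (↭-trans (↭-sym (allPoints-↭ F↭c∷R)) F↭C)
                   (subst₂ _≤_ (trans (cong side shape≡) (sym |C|≡n)) refl (side≤ b))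
    |b|≡n : length (points b) ≡ n
    |b|≡n = trans (↭-length b↭C) |C|≡n
    from-origin : Origin b → ShiftedSumOfBases C
    from-origin (single |b|≡1) = ⊥-elim (<-irrefl refl (subst (2 ≤_) (trans (sym |b|≡n) |b|≡1) 2≤n))
    from-origin (merged b₁ b₂ points≡ hull≡ sides) =
      merged-basis b₁ b₂ (subst Unique points≡ (Unique-resp-↭ (↭-sym b↭C) (proj₁ config)))
        (trans (sym hull≡) (trans shape≡ (cong (tri 0 0) (sym |g|≡n))))
        (subst (_≤ side (shape b₁) + side (shape b₂)) (trans (cong side shape≡) (sym |g|≡n)) sides)
        (subst (C ≋_) points≡ (↭⇒≋ b↭C))
      where
      |g|≡n : length (points b₁ ++ points b₂) ≡ n
      |g|≡n = trans (cong length (sym points≡)) |b|≡n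

  merge-blocks : ∀ k F → length F ≡ k → allPoints F ↭ C → ShiftedSumOfBases C
  merge-blocks zero [] _ []↭C = ⊥-elim (<-irrefl (trans (↭-length []↭C) |C|≡n) (<-trans z<s 2≤n))
  merge-blocks zero (_ ∷ _) ()
  merge-blocks (suc k) F |F|≡ F↭C with touching? F
  ... | no ¬touch = from-apart-blocks F ¬touch F↭C
  ... | yes (x , _ , y , _ , w , two)
    with (b₁ , _) , (b₂ , _) , R , a∈b₁ , b∈b₂ , F↭ ← Any₂-↭ two
    = merge-blocks k (fuse b₁ b₂ a∈b₁ b∈b₂ (cells-adjacent w x y) ∷ R)
        (suc-injective (trans (sym (↭-length F↭)) |F|≡))
        (↭-trans (↭-reflexive (++-assoc (points b₁) (points b₂) (allPoints R)))
                 (↭-trans (↭-sym (allPoints-↭ F↭)) F↭C))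

  decomposition : ShiftedSumOfBases C
  decomposition =
    merge-blocks (length C) (map singleton C) (length-map singleton C) (↭-reflexive (allPoints-singletons C))

basis-decomposes : ∀ {n C} → 1 ≤ n → TriangleBasis n C → (∃[ p ] C ≡ p ∷ []) ⊎ ShiftedSumOfBases C
basis-decomposes {suc zero} {[]}        _ ((_ , () , _) , _)
basis-decomposes {suc zero} {p ∷ []}    _ _ = inj₁ (p , refl)
basis-decomposes {suc zero} {_ ∷ _ ∷ _} _ ((_ , () , _) , _)
basis-decomposes {suc (suc k)} _ (config , spans) =
  inj₂ (Decomposition.decomposition config (λ {p} → Equivalence.from (spans p)) (s≤s (s≤s z≤n)))

mainTheorem3 : ∀ (n : ℕ) (C : List Pt) → 1 ≤ n → IsConfig n C →
    TriangleBasis n C ⇔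
      ((∃[ p ] C ≡ p ∷ [])
       ⊎ (∃[ n₁ ] ∃[ n₂ ] ∃[ C₁ ] ∃[ C₂ ] ∃[ h ]
            (1 ≤ n₁ × 1 ≤ n₂ × TriangleBasis n₁ C₁ × TriangleBasis n₂ C₂ × h ≤ n₁
             × (C ≋ vSum C₁ C₂ h ⊎ C ≋ hSum C₁ C₂ h ⊎ C ≋ dSum C₁ C₂ h))))
mainTheorem3 n C 1≤n config = mk⇔ (basis-decomposes 1≤n) compose
  where
  compose : (∃[ p ] C ≡ p ∷ []) ⊎ ShiftedSumOfBases C → TriangleBasis n C
  compose (inj₁ (p , refl)) = singleton-basis config
  compose (inj₂ (_ , _ , _ , _ , _ , 1≤n₁ , 1≤n₂ , basis₁ , basis₂ , h≤n₁ , sum)) =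
    shifted-sum-basis config 1≤n₁ 1≤n₂ h≤n₁ basis₁ basis₂ sum
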